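{- Let $AB$ be an edge of a pendant tree $T$ of a graph $G$, and let $a_{max}\in A$ and $b_{max}\in B$ be vertices of maximum degree (in $G$) within $A$ and $B$, respectively. Then $\{a_{max},b_{max}\}$ is non-pendant.
   Context: Graphs are finite, undirected (parallel edges allowed). For $X\subseteq V$, $d_G(X)$ is the number of edges with exactly one endpoint in $X$. For vertices $v\neq w$, $\lambda_G(v,w)$ is the minimum of $d_G(X)$ over $X$ containing exactly one of $v,w$. A pair $\{v,w\}$ of distinct vertices is pendant if $\lambda_G(v,w)=\min\{d_G(v),d_G(w)\}$. For a tree $T$ whose vertex set (blocks) is a partition of $V$ and an edge $AB$ of $T$, $C_{AB}$ is the union of blocks in the component of $T-AB$ containing $A$, and $c(AB):=d_G(C_{AB})$. A pendant tree of $G$ is such a tree with: (i) every two distinct vertices in a common block form a pendant pair; (ii) for every edge $AB$ there are $a\in A$, $b\in B$ with $\{a,b\}$ non-pendant; (iii) for every edge $AB$ there are $a^*\in A$, $b^*\in B$ with $c(AB)=\lambda_G(a^*,b^*)$. -}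

module Defs where

open import Data.Nat using (ℕ; zero; suc; _+_; _⊓_; _≤_)
open import Data.Bool using (Bool; true; false; if_then_else_; _xor_)
open import Data.Fin using (Fin)
open import Data.Vec using (Vec; []; _∷_; lookup)
open import Data.List using (List; []; _∷_; map; _++_; foldr; length)
open import Data.Nat.ListAction using (sum)
open import Data.List.Membership.Propositional using (_∈_)
open import Data.Product using (_×_; _,_; Σ; ∃; ∃-syntax)
open import Data.Sum using (_⊎_)
open import Relation.Nullary using (¬_)
open import Relation.Binary.PropositionalEquality using (_≡_; _≢_)
open import Relation.Binary.Construct.Closure.ReflexiveTransitive using (Star)
open import Function.Bundles using (_⇔_)

-- A finite multigraph on vertex set Fin n, given by its list of edges
-- (each edge an unordered pair, written as an ordered pair; repeated
-- entries are parallel edges).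
Edges : ℕ → Set
Edges n = List (Fin n × Fin n)

Subset : ℕ → Set
Subset n = Vec Bool n

cut : ∀ {n} → Edges n → Subset n → ℕ
cut E X = sum (map (λ { (u , v) → if lookup X u xor lookup X v then 1 else 0 }) E)

single : ∀ {n} → Fin n → Subset n
single {suc n} Fin.zero = true ∷ Data.Vec.replicate n false
single {suc n} (Fin.suc v) = false ∷ single v

deg : ∀ {n} → Edges n → Fin n → ℕ
deg E v = cut E (single v)

allSubsets : ∀ n → List (Subset n)
allSubsets zero = [] ∷ []
allSubsets (suc n) = map (true ∷_) (allSubsets n) ++ map (false ∷_) (allSubsets n)

-- λ_G(v,w): minimum of d_G(X) over X containing exactly one of v,w.
-- Every d_G(X) is ≤ |E|, and for v ≠ w a separating X exists, so starting
-- the minimum at |E| (and replacing non-separating X by |E|) gives exactly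
-- the minimum.
lam : ∀ {n} → Edges n → Fin n → Fin n → ℕ
lam E v w = foldr _⊓_ (length E)
  (map (λ X → if lookup X v xor lookup X w then cut E X else length E) (allSubsets _))

Pendant : ∀ {n} → Edges n → Fin n → Fin n → Set
Pendant E v w = lam E v w ≡ deg E v ⊓ deg E w

TAdj : ∀ {k} → Edges k → Fin k → Fin k → Set
TAdj T x y = (x , y) ∈ T ⊎ (y , x) ∈ T

TAdjMinus : ∀ {k} → Edges k → Fin k → Fin k → Fin k → Fin k → Set
TAdjMinus T A B x y = TAdj T x y × ¬ ((x ≡ A × y ≡ B) ⊎ (x ≡ B × y ≡ A))

-- T is a tree: connected, and minimally so (removing any edge disconnects
-- its endpoints; this also excludes loops and parallel edges).
IsTree : ∀ {k} → Edges k → Set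
IsTree {k} T =
  (∀ (x y : Fin k) → Star (TAdj T) x y) ×
  (∀ (A B : Fin k) → (A , B) ∈ T → ¬ Star (TAdjMinus T A B) A B)

-- A pendant tree of G = (Fin n, E): k blocks, blk v = block containing v
-- (surjective: blocks are nonempty, so the blocks form a partition of V),
-- tree T on the blocks, satisfying (i), (ii), (iii).
record PendantTree {n} (E : Edges n) (k : ℕ) (blk : Fin n → Fin k) (T : Edges k) : Set where
  field
    blocksNonempty : ∀ (A : Fin k) → ∃[ v ] blk v ≡ A
    tree : IsTree T
    cond-i : ∀ (v w : Fin n) → v ≢ w → blk v ≡ blk w → Pendant E v w
    cond-ii : ∀ (A B : Fin k) → TAdj T A B →
      ∃[ a ] ∃[ b ] (blk a ≡ A × blk b ≡ B × ¬ Pendant E a b)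
    -- (iii): for any X equal to C_AB (union of blocks in the component of
    -- T − AB containing A), c(AB) = d_G(X) equals λ_G(a*,b*) for some
    -- a* ∈ A, b* ∈ B.
    cond-iii : ∀ (A B : Fin k) → TAdj T A B → ∀ (X : Subset n) →
      (∀ v → (lookup X v ≡ true) ⇔ Star (TAdjMinus T A B) A (blk v)) →
      ∃[ a ] ∃[ b ] (blk a ≡ A × blk b ≡ B × cut E X ≡ lam E a b)

module Submission where

-- Let a ∈ A, b ∈ B be the non-pendant pair given by condition (ii)
-- for the tree edge AB.  Always λ(a,b) ≤ min(d(a), d(b)), so it suffices
-- to derive min(d(a), d(b)) ≤ λ(a,b) from the assumption that
-- {amax, bmax} is pendant.  Local edge-connectivity satisfies the
-- ultrametric inequality λ(x,z) ≥ min(λ(x,y), λ(y,z)), whence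
--   λ(a,b) ≥ min(λ(a,amax), λ(amax,bmax), λ(bmax,b)).
-- Inside a block every pair is pendant, so λ(a,amax) = d(a) since
-- d(a) ≤ d(amax) (and likewise for b, bmax); the assumed pendancy gives
-- λ(amax,bmax) = min(d(amax), d(bmax)) ≥ min(d(a), d(b)).

open import Defs
open import Data.Nat using (ℕ; zero; suc; _≤_; _⊓_; z≤n; s≤s)
open import Data.Nat.Properties
  using (≤-refl; ≤-trans; ≤-reflexive; ≤-antisym; m≤n⇒m≤1+n;
         m⊓n≤m; m⊓n≤n; ⊓-glb; ⊓-mono-≤; m≤n⇒m⊓n≡m)
open import Data.Fin using (Fin; _≟_)
open import Data.Bool using (true; false; _xor_; if_then_else_)
open import Data.Bool.Properties using (xor-comm)
open import Data.Vec using ([]; _∷_; lookup)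
open import Data.Vec.Properties using (lookup-replicate)
open import Data.List using (List; []; _∷_; map; foldr; length)
open import Data.List.Membership.Propositional using (_∈_)
open import Data.List.Membership.Propositional.Properties using (∈-map⁺; ∈-++⁺ˡ; ∈-++⁺ʳ)
open import Data.List.Relation.Unary.Any using (here; there)
open import Data.Product using (_,_; proj₂)
open import Data.Sum using (_⊎_; inj₁; inj₂)
open import Relation.Nullary using (¬_; yes; no)
open import Relation.Binary.PropositionalEquality using (_≡_; _≢_; refl; sym; trans; cong; cong₂)
open import Relation.Binary.Construct.Closure.ReflexiveTransitive using (ε)

module _ {A : Set} (f : A → ℕ) (z : ℕ) where

  foldMin-≤-elem : ∀ xs {x} → x ∈ xs → foldr _⊓_ z (map f xs) ≤ f x
  foldMin-≤-elem (y ∷ xs) (here refl) = m⊓n≤m (f y) _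
  foldMin-≤-elem (y ∷ xs) (there x∈xs) = ≤-trans (m⊓n≤n (f y) _) (foldMin-≤-elem xs x∈xs)

  foldMin-≤-default : ∀ xs → foldr _⊓_ z (map f xs) ≤ z
  foldMin-≤-default [] = ≤-refl
  foldMin-≤-default (y ∷ xs) = ≤-trans (m⊓n≤n (f y) _) (foldMin-≤-default xs)

  foldMin-glb : ∀ xs {m} → m ≤ z → (∀ x → m ≤ f x) → m ≤ foldr _⊓_ z (map f xs)
  foldMin-glb [] m≤z m≤f = m≤z
  foldMin-glb (y ∷ xs) m≤z m≤f = ⊓-glb (m≤f y) (foldMin-glb xs m≤z m≤f)

∈-allSubsets : ∀ n (X : Subset n) → X ∈ allSubsets n
∈-allSubsets zero [] = here refl
∈-allSubsets (suc n) (true ∷ X) = ∈-++⁺ˡ (∈-map⁺ (true ∷_) (∈-allSubsets n X))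
∈-allSubsets (suc n) (false ∷ X) =
  ∈-++⁺ʳ (map (true ∷_) (allSubsets n)) (∈-map⁺ (false ∷_) (∈-allSubsets n X))

Separates : ∀ {n} → Subset n → Fin n → Fin n → Set
Separates X v w = lookup X v xor lookup X w ≡ true

separates-split : ∀ a b c → a xor c ≡ true → a xor b ≡ true ⊎ b xor c ≡ true
separates-split true  true  false refl = inj₂ refl
separates-split true  false false refl = inj₁ refl
separates-split false true  true  refl = inj₁ refl
separates-split false false true  refl = inj₂ refl

cut-≤-size : ∀ {n} (E : Edges n) X → cut E X ≤ length E
cut-≤-size [] X = z≤n
cut-≤-size ((u , v) ∷ E) X with lookup X u xor lookup X v
... | true = s≤s (cut-≤-size E X)
... | false = m≤n⇒m≤1+n (cut-≤-size E X)

separatedCut : ∀ {n} → Edges n → Fin n → Fin n → Subset n → ℕ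
separatedCut E v w Y = if lookup Y v xor lookup Y w then cut E Y else length E

lam-≤-cut : ∀ {n} (E : Edges n) {v w} X → Separates X v w → lam E v w ≤ cut E X
lam-≤-cut {n} E {v} {w} X sep =
  ≤-trans (foldMin-≤-elem (separatedCut E v w) (length E) (allSubsets n) (∈-allSubsets n X))
          (≤-reflexive (cong (if_then cut E X else length E) sep))

lam-≤-size : ∀ {n} (E : Edges n) v w → lam E v w ≤ length E
lam-≤-size {n} E v w = foldMin-≤-default _ (length E) (allSubsets n)

lam-glb : ∀ {n} (E : Edges n) v w {m} → m ≤ length E →
  (∀ X → Separates X v w → m ≤ cut E X) → m ≤ lam E v w
lam-glb {n} E v w {m} m≤size m≤cut =
  foldMin-glb (separatedCut E v w) (length E) (allSubsets n) m≤size m≤separatedCut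
  where
  m≤separatedCut : ∀ X → m ≤ separatedCut E v w X
  m≤separatedCut X with lookup X v xor lookup X w in sep
  ... | true = m≤cut X sep
  ... | false = m≤size

lam-sym-≤ : ∀ {n} (E : Edges n) v w → lam E v w ≤ lam E w v
lam-sym-≤ E v w = lam-glb E w v (lam-≤-size E v w)
  (λ X sep → lam-≤-cut E X (trans (xor-comm (lookup X v) (lookup X w)) sep))

lam-sym : ∀ {n} (E : Edges n) v w → lam E v w ≡ lam E w v
lam-sym E v w = ≤-antisym (lam-sym-≤ E v w) (lam-sym-≤ E w v)

lam-ultrametric : ∀ {n} (E : Edges n) x y z → lam E x y ⊓ lam E y z ≤ lam E x z
lam-ultrametric E x y z = lam-glb E x z (≤-trans (m⊓n≤m _ _) (lam-≤-size E x y)) bound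
  where
  bound : ∀ X → Separates X x z → lam E x y ⊓ lam E y z ≤ cut E X
  bound X sep with separates-split (lookup X x) (lookup X y) (lookup X z) sep
  ... | inj₁ sep-xy = ≤-trans (m⊓n≤m _ _) (lam-≤-cut E X sep-xy)
  ... | inj₂ sep-yz = ≤-trans (m⊓n≤n _ _) (lam-≤-cut E X sep-yz)

lam-ultrametric₃ : ∀ {n} (E : Edges n) x y z w →
  lam E x y ⊓ lam E y z ⊓ lam E z w ≤ lam E x w
lam-ultrametric₃ E x y z w =
  ≤-trans (⊓-mono-≤ (lam-ultrametric E x y z) ≤-refl) (lam-ultrametric E x z w)

-- A vertex is separated from itself by no set, so λ(v,v) = |E|.
lam-self : ∀ {n} (E : Edges n) v → length E ≤ lam E v v
lam-self E v = lam-glb E v v ≤-refl noSeparation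
  where
  noSeparation : ∀ X → Separates X v v → length E ≤ cut E X
  noSeparation X sep with lookup X v
  noSeparation X () | true
  noSeparation X () | false

single-self : ∀ {n} (v : Fin n) → lookup (single v) v ≡ true
single-self Fin.zero = refl
single-self (Fin.suc v) = single-self v

single-other : ∀ {n} (v w : Fin n) → v ≢ w → lookup (single v) w ≡ false
single-other Fin.zero Fin.zero v≢w with v≢w refl
... | ()
single-other {suc n} Fin.zero (Fin.suc w) v≢w = lookup-replicate w false
single-other (Fin.suc v) Fin.zero v≢w = refl
single-other (Fin.suc v) (Fin.suc w) v≢w = single-other v w (λ v≡w → v≢w (cong Fin.suc v≡w))

-- For distinct v, w the singletons separate them, so λ(v,w) ≤ min(d(v), d(w)).
lam-≤-deg : ∀ {n} (E : Edges n) {v w} → v ≢ w → lam E v w ≤ deg E v ⊓ deg E w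
lam-≤-deg E {v} {w} v≢w = ⊓-glb
  (lam-≤-cut E (single v) (cong₂ _xor_ (single-self v) (single-other v w v≢w)))
  (lam-≤-cut E (single w) (cong₂ _xor_ (single-other w v (λ w≡v → v≢w (sym w≡v))) (single-self w)))

module _ {n k} {E : Edges n} {blk : Fin n → Fin k} {T : Edges k}
         (PT : PendantTree E k blk T) where
  open PendantTree PT

  tree-edge-distinct : ∀ {A B} → TAdj T A B → A ≢ B
  tree-edge-distinct {A} (inj₁ AA∈T) refl = proj₂ tree A A AA∈T ε
  tree-edge-distinct {A} (inj₂ AA∈T) refl = proj₂ tree A A AA∈T ε

  -- Within a block, d(x) ≤ λ(x,y) whenever d(x) ≤ d(y): for x ≠ y the pair
  -- is pendant by (i), and for x = y we have d(x) ≤ |E| = λ(x,x).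
  deg-≤-lam-in-block : ∀ {x y} → blk x ≡ blk y → deg E x ≤ deg E y → deg E x ≤ lam E x y
  deg-≤-lam-in-block {x} {y} sameBlock dx≤dy with x ≟ y
  ... | yes refl = ≤-trans (cut-≤-size E (single x)) (lam-self E x)
  ... | no x≢y = ≤-reflexive (trans (sym (m≤n⇒m⊓n≡m dx≤dy)) (sym (cond-i x y x≢y sameBlock)))

lemma7 : ∀ {n k : ℕ} (E : Edges n) (blk : Fin n → Fin k) (T : Edges k) →
    PendantTree E k blk T →
    ∀ (A B : Fin k) → TAdj T A B →
    ∀ (amax bmax : Fin n) →
    blk amax ≡ A → (∀ v → blk v ≡ A → deg E v ≤ deg E amax) →
    blk bmax ≡ B → (∀ v → blk v ≡ B → deg E v ≤ deg E bmax) →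
    ¬ Pendant E amax bmax
lemma7 E blk T PT A B AB amax bmax amax∈A amaxMax bmax∈B bmaxMax maxPendant
  with PendantTree.cond-ii PT A B AB
... | a , b , a∈A , b∈B , abNonPendant = abNonPendant (≤-antisym (lam-≤-deg E a≢b) degs≤lam)
  where
  a≢b : a ≢ b
  a≢b a≡b = tree-edge-distinct PT AB (trans (sym a∈A) (trans (cong blk a≡b) b∈B))
  da≤damax : deg E a ≤ deg E amax
  da≤damax = amaxMax a a∈A
  db≤dbmax : deg E b ≤ deg E bmax
  db≤dbmax = bmaxMax b b∈B
  -- the three steps of the path a – amax – bmax – b
  a-amax : deg E a ≤ lam E a amax
  a-amax = deg-≤-lam-in-block PT (trans a∈A (sym amax∈A)) da≤damax
  amax-bmax : deg E a ⊓ deg E b ≤ lam E amax bmax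
  amax-bmax = ≤-trans (⊓-mono-≤ da≤damax db≤dbmax) (≤-reflexive (sym maxPendant))
  bmax-b : deg E b ≤ lam E bmax b
  bmax-b = ≤-trans (deg-≤-lam-in-block PT (trans b∈B (sym bmax∈B)) db≤dbmax)
                   (≤-reflexive (lam-sym E b bmax))
  degs≤lam : deg E a ⊓ deg E b ≤ lam E a b
  degs≤lam = ≤-trans
    (⊓-glb (⊓-glb (≤-trans (m⊓n≤m _ _) a-amax) amax-bmax) (≤-trans (m⊓n≤n _ _) bmax-b))
    (lam-ultrametric₃ E a amax bmax b)
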